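{- The diamond graph $\mathfrak{D}=K_4-e$ (the complete graph on four vertices with one edge removed) is not $i$-graph realizable; that is, there is no graph $G$ with $\mathcal{I}(G)\cong K_4-e$.
   Context: All graphs are finite and simple. For a graph $G$, $i(G)$ denotes the independent domination number: the minimum cardinality of an independent dominating set (equivalently, of a maximal independent set) of $G$; an independent dominating set of cardinality $i(G)$ is an $i$-set of $G$. The $i$-graph $\mathcal{I}(G)$ of $G$ is the graph whose vertices are the $i$-sets of $G$, where two $i$-sets $S$ and $S'$ are adjacent if and only if there is an edge $xy\in E(G)$ with $S'=(S-\{x\})\cup\{y\}$. A graph $H$ is $i$-graph realizable (is an $i$-graph) if there exists a graph $G$ with $\mathcal{I}(G)\cong H$. -}

module Defs where

open import Data.Nat using (ℕ; _≤_)
open import Data.Fin using (Fin; zero; suc)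
open import Data.Fin.Subset using (Subset; _∈_; _∉_; _∪_; _-_; ⁅_⁆; ∣_∣)
open import Data.Product using (Σ; ∃; ∃-syntax; _×_)
open import Data.Sum using (_⊎_)
open import Data.Empty using (⊥)
open import Data.Unit using (⊤)
open import Relation.Nullary using (¬_)
open import Relation.Binary using (Decidable)
open import Relation.Binary.PropositionalEquality using (_≡_; _≢_)
open import Function.Bundles using (_⇔_)

record Graph : Set₁ where
  field
    n       : ℕ
    Adj     : Fin n → Fin n → Set
    adj?    : Decidable Adj
    sym     : ∀ {x y} → Adj x y → Adj y x
    irrefl  : ∀ {x} → ¬ Adj x x

module _ (G : Graph) where
  open Graph G

  Independent : Subset n → Set
  Independent S = ∀ x y → x ∈ S → y ∈ S → ¬ Adj x y

  Dominating : Subset n → Set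
  Dominating S = ∀ v → v ∈ S ⊎ (∃[ u ] (u ∈ S × Adj u v))

  IndependentDominating : Subset n → Set
  IndependentDominating S = Independent S × Dominating S

  IsISet : Subset n → Set
  IsISet S = IndependentDominating S × (∀ T → IndependentDominating T → ∣ S ∣ ≤ ∣ T ∣)

  IAdj : Subset n → Subset n → Set
  IAdj S S' = S ≢ S' × (∃[ x ] ∃[ y ] (Adj x y × S' ≡ (S - x) ∪ ⁅ y ⁆))

  IGraphIso : (k : ℕ) → (Fin k → Fin k → Set) → Set
  IGraphIso k H =
    Σ (Fin k → Subset n) λ f →
      (∀ a → IsISet (f a)) ×
      (∀ a b → f a ≡ f b → a ≡ b) ×
      (∀ S → IsISet S → ∃[ a ] (f a ≡ S)) ×
      (∀ a b → H a b ⇔ IAdj (f a) (f b))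

IGraphRealizable : (k : ℕ) → (Fin k → Fin k → Set) → Set₁
IGraphRealizable k H = Σ Graph λ G → IGraphIso G k H

-- The diamond K₄ - e on Fin 4, with the removed edge being {2,3}.
DiamondAdj : Fin 4 → Fin 4 → Set
DiamondAdj zero zero = ⊥
DiamondAdj zero (suc _) = ⊤
DiamondAdj (suc zero) zero = ⊤
DiamondAdj (suc zero) (suc zero) = ⊥
DiamondAdj (suc zero) (suc (suc _)) = ⊤
DiamondAdj (suc (suc zero)) zero = ⊤
DiamondAdj (suc (suc zero)) (suc zero) = ⊤
DiamondAdj (suc (suc zero)) (suc (suc _)) = ⊥
DiamondAdj (suc (suc (suc zero))) zero = ⊤
DiamondAdj (suc (suc (suc zero))) (suc zero) = ⊤
DiamondAdj (suc (suc (suc zero))) (suc (suc _)) = ⊥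

{-# OPTIONS --safe #-}
-- Every neighbour B of an i-set A in the i-graph is an exchange B = (A - x) ∪ {y} with x ∈ A,
-- y ∉ A and xy an edge.  If two exchanges of A are adjacent to each other, they remove the
-- same vertex; and two distinct exchanges of A removing the same vertex are always adjacent,
-- since the vertex dominating the second added vertex must be the first added vertex.  In
-- K₄ - e, let A and B be the two vertices of degree three and C, D the non-adjacent pair:
-- C and D both remove the vertex of A that B removes, hence C ~ D.
module Submission where

open import Data.Nat using (ℕ)
open import Data.Fin using (Fin; _≟_; #_)
open import Data.Fin.Subset using (Subset; _∈_; _∉_; _∪_; _-_; _─_; ⁅_⁆; inside; outside)
open import Data.Fin.Subset.Properties
  using (_∈?_; x∈p∪q⁻; x∈p∪q⁺; x∈⁅x⁆; x∈⁅y⁆⇒x≡y; x∈p∧x≢y⇒x∈p-y; p─q⊆p; ⊆-antisym)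
open import Data.Vec using (_∷_; here; there)
open import Data.Product using (∃-syntax; _×_; _,_; proj₁; proj₂)
open import Data.Sum using (_⊎_; inj₁; inj₂; [_,_])
open import Data.Empty using (⊥-elim)
open import Function using (_∘_)
open import Function.Bundles using (Equivalence)
open import Relation.Nullary using (¬_; yes; no)
open import Relation.Binary.PropositionalEquality using (_≡_; _≢_; refl; sym; trans; subst)

open import Defs

private
  variable
    n : ℕ
    S : Subset n
    v x y z : Fin n

x∈p─q⇒x∉q : (p q : Subset n) → v ∈ p ─ q → v ∉ q
x∈p─q⇒x∉q (inside ∷ p) (outside ∷ q) here        ()
x∈p─q⇒x∉q (_ ∷ p)      (outside ∷ q) (there v∈) (there v∈q) = x∈p─q⇒x∉q p q v∈ v∈q
x∈p─q⇒x∉q (_ ∷ p)      (inside ∷ q)  (there v∈) (there v∈q) = x∈p─q⇒x∉q p q v∈ v∈q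

x∈p-y⇒x≢y : v ∈ S - y → v ≢ y
x∈p-y⇒x≢y {S = S} {y = y} v∈ refl = x∈p─q⇒x∉q S ⁅ y ⁆ v∈ (x∈⁅x⁆ y)

swap : Subset n → Fin n → Fin n → Subset n
swap S x y = (S - x) ∪ ⁅ y ⁆

∈-swap⁻ : v ∈ swap S x y → (v ∈ S × v ≢ x) ⊎ v ≡ y
∈-swap⁻ {S = S} {x} {y} v∈ with x∈p∪q⁻ (S - x) ⁅ y ⁆ v∈
... | inj₁ v∈S-x = inj₁ (p─q⊆p S ⁅ x ⁆ v∈S-x , x∈p-y⇒x≢y v∈S-x)
... | inj₂ v∈⁅y⁆ = inj₂ (x∈⁅y⁆⇒x≡y y v∈⁅y⁆)

∈-swap⁺ˡ : v ∈ S → v ≢ x → v ∈ swap S x y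
∈-swap⁺ˡ v∈S v≢x = x∈p∪q⁺ (inj₁ (x∈p∧x≢y⇒x∈p-y v∈S v≢x))

∈-swap⁺ʳ : y ∈ swap S x y
∈-swap⁺ʳ = x∈p∪q⁺ (inj₂ (x∈⁅x⁆ _))

swap-∉-∈ : x ∉ S → y ∈ S → swap S x y ≡ S
swap-∉-∈ x∉S y∈S = ⊆-antisym
  (λ v∈ → [ proj₁ , (λ { refl → y∈S }) ] (∈-swap⁻ v∈))
  (λ v∈S → ∈-swap⁺ˡ v∈S (λ { refl → x∉S v∈S }))

swap-swap : {S : Subset n} {x y z : Fin n} → y ∉ S → swap (swap S x y) y z ≡ swap S x z
swap-swap {S = S} {x} {y} {z} y∉S = ⊆-antisym (forth ∘ ∈-swap⁻) (back ∘ ∈-swap⁻)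
  where
  forth : ∀ {v} → (v ∈ swap S x y × v ≢ y) ⊎ v ≡ z → v ∈ swap S x z
  forth (inj₁ (v∈ , v≢y)) with ∈-swap⁻ v∈
  ... | inj₁ (v∈S , v≢x) = ∈-swap⁺ˡ v∈S v≢x
  ... | inj₂ v≡y         = ⊥-elim (v≢y v≡y)
  forth (inj₂ refl) = ∈-swap⁺ʳ
  back : ∀ {v} → (v ∈ S × v ≢ x) ⊎ v ≡ z → v ∈ swap (swap S x y) y z
  back (inj₁ (v∈S , v≢x)) = ∈-swap⁺ˡ (∈-swap⁺ˡ v∈S v≢x) (λ { refl → y∉S v∈S })
  back (inj₂ refl)        = ∈-swap⁺ʳ

module _ (G : Graph) where
  open Graph G using (Adj)

  private
    variable
      A B P Q : Subset (Graph.n G)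

  record Exchange (A B : Subset (Graph.n G)) : Set where
    constructor exchange
    field
      removed   : Fin (Graph.n G)
      added     : Fin (Graph.n G)
      removed∈  : removed ∈ A
      added∉    : added ∉ A
      edge      : Adj removed added
      B≡swap    : B ≡ swap A removed added

  open Exchange

  IAdj⇒Exchange : Independent G A → Dominating G A → Independent G B → IAdj G A B → Exchange A B
  IAdj⇒Exchange {A} iA dA iB (A≢B , x , y , x~y , refl) with x ∈? A
  ... | yes x∈A = exchange x y x∈A (λ y∈A → iA x y x∈A y∈A x~y) x~y refl
  ... | no x∉A with y ∈? A
  ...   | yes y∈A = ⊥-elim (A≢B (sym (swap-∉-∈ x∉A y∈A)))
  ...   | no y∉A = ⊥-elim (undominated (dA y))
    where
    undominated : ¬ (y ∈ A ⊎ ∃[ u ] (u ∈ A × Adj u y))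
    undominated (inj₁ y∈A)            = y∉A y∈A
    undominated (inj₂ (u , u∈A , u~y)) = iB u y (∈-swap⁺ˡ u∈A (λ { refl → x∉A u∈A })) ∈-swap⁺ʳ u~y

  IAdj⇒added-unique : IAdj G P Q → v ∈ Q → v ∉ P → z ∈ Q → z ∉ P → v ≡ z
  IAdj⇒added-unique {P} (_ , x , y , _ , refl) v∈Q v∉P z∈Q z∉P =
    trans (added≡y v∈Q v∉P) (sym (added≡y z∈Q z∉P))
    where
    added≡y : ∀ {u} → u ∈ swap P x y → u ∉ P → u ≡ y
    added≡y u∈ u∉P with ∈-swap⁻ u∈
    ... | inj₁ (u∈P , _) = ⊥-elim (u∉P u∈P)
    ... | inj₂ u≡y       = u≡y

  -- If the removed vertices differed, both the vertex removed by P and the vertex added by Q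
  -- would lie in Q but not in P.
  adjacent-exchanges⇒same-removed : (e : Exchange A P) (f : Exchange A Q) →
                                    Independent G P → IAdj G P Q → removed e ≡ removed f
  adjacent-exchanges⇒same-removed {A}
    (exchange xp yp xp∈A yp∉A _ refl) (exchange xq yq xq∈A yq∉A xq~yq refl) iP P~Q
    with xp ≟ xq
  ... | yes xp≡xq = xp≡xq
  ... | no xp≢xq =
    ⊥-elim (yq∉A (subst (_∈ A) (IAdj⇒added-unique P~Q (∈-swap⁺ˡ xp∈A xp≢xq) xp∉P ∈-swap⁺ʳ yq∉P) xp∈A))
    where
    xp∉P : xp ∉ swap A xp yp
    xp∉P xp∈P with ∈-swap⁻ xp∈P
    ... | inj₁ (_ , xp≢xp) = xp≢xp refl
    ... | inj₂ refl        = yp∉A xp∈A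
    yq∉P : yq ∉ swap A xp yp
    yq∉P yq∈P with ∈-swap⁻ yq∈P
    ... | inj₁ (yq∈A , _) = yq∉A yq∈A
    ... | inj₂ refl       = iP xq yq (∈-swap⁺ˡ xq∈A (xp≢xq ∘ sym)) ∈-swap⁺ʳ xq~yq

  same-removed⇒IAdj : (e : Exchange A P) (f : Exchange A Q) → removed e ≡ removed f →
                      P ≢ Q → Dominating G P → Independent G Q → IAdj G P Q
  same-removed⇒IAdj {A}
    (exchange x yp _ yp∉A _ refl) (exchange _ yq _ yq∉A _ refl) refl P≢Q dP iQ = via (dP yq)
    where
    yq∉P : yq ∉ swap A x yp
    yq∉P yq∈P with ∈-swap⁻ yq∈P
    ... | inj₁ (yq∈A , _) = yq∉A yq∈A
    ... | inj₂ refl       = P≢Q refl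
    via : yq ∈ swap A x yp ⊎ ∃[ u ] (u ∈ swap A x yp × Adj u yq) → IAdj G (swap A x yp) (swap A x yq)
    via (inj₁ yq∈P) = ⊥-elim (yq∉P yq∈P)
    via (inj₂ (u , u∈P , u~yq)) with ∈-swap⁻ u∈P
    ... | inj₁ (u∈A , u≢x) = ⊥-elim (iQ u yq (∈-swap⁺ˡ u∈A u≢x) ∈-swap⁺ʳ u~yq)
    ... | inj₂ refl        = P≢Q , yp , yq , u~yq , sym (swap-swap yp∉A)

proposition3p1 : ¬ IGraphRealizable 4 DiamondAdj
proposition3p1 (G , f , isISet , injective , _ , iso) = Equivalence.from (iso (# 2) (# 3)) C~D
  where
  independent : ∀ a → Independent G (f a)
  independent a = proj₁ (proj₁ (isISet a))
  dominating : ∀ a → Dominating G (f a)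
  dominating a = proj₂ (proj₁ (isISet a))
  adjacent : ∀ a b → DiamondAdj a b → IAdj G (f a) (f b)
  adjacent a b = Equivalence.to (iso a b)
  exchangeFromA : ∀ b → DiamondAdj (# 0) b → Exchange G (f (# 0)) (f b)
  exchangeFromA b A~b =
    IAdj⇒Exchange G (independent (# 0)) (dominating (# 0)) (independent b) (adjacent (# 0) b A~b)
  removesAsB : ∀ b → DiamondAdj (# 1) b → (A~b : DiamondAdj (# 0) b) →
               Exchange.removed (exchangeFromA (# 1) _) ≡ Exchange.removed (exchangeFromA b A~b)
  removesAsB b B~b A~b = adjacent-exchanges⇒same-removed G
    (exchangeFromA (# 1) _) (exchangeFromA b A~b) (independent (# 1)) (adjacent (# 1) b B~b)
  C≢D : f (# 2) ≢ f (# 3)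
  C≢D C≡D with injective (# 2) (# 3) C≡D
  ... | ()
  C~D : IAdj G (f (# 2)) (f (# 3))
  C~D = same-removed⇒IAdj G (exchangeFromA (# 2) _) (exchangeFromA (# 3) _)
    (trans (sym (removesAsB (# 2) _ _)) (removesAsB (# 3) _ _))
    C≢D (dominating (# 2)) (independent (# 3))
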